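{- There exist constants $C, c > 0$ such that for arbitrarily large $N$ there is a pair of unrooted binary phylogenetic trees $T_1, T_2$ on a common leaf set of size $N$ for which the minimum size of a relaxed agreement forest of $T_1, T_2$ is at most $C$ while the minimum size of an agreement forest of $T_1, T_2$ is at least $cN$. (That is, there are instances where MAF is arbitrarily large, $\Omega(N)$, while MRAF is constant.)
   Context: An unrooted binary phylogenetic tree on a finite set $X$ is a simple connected undirected tree whose leaves are bijectively labeled by $X$ and whose non-leaf vertices all have degree $3$. $T = T'$ means there is a label-preserving isomorphism. For $X' \subseteq X$, $T[X']$ is the minimal subtree of $T$ connecting the leaves in $X'$, and $T|X'$ is obtained from $T[X']$ by suppressing degree-$2$ vertices. A relaxed agreement forest (RAF) of $T_1, T_2$ (trees on the same $X$) is a partition $\{S_1,\ldots,S_k\}$ of $X$ with $T_1|S_i = T_2|S_i$ for every $i$; an agreement forest (AF) is a RAF that additionally satisfies: for all $i \neq j$, $T_1[S_i]$ and $T_1[S_j]$ are vertex-disjoint, and $T_2[S_i]$ and $T_2[S_j]$ are vertex-disjoint. The size of a (relaxed) agreement forest is its number of blocks; MRAF and MAF denote the minimum sizes of a RAF and an AF respectively. -}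

module Defs where

open import Data.Nat using (ℕ; zero; suc; _+_; _*_; _≤_)
open import Data.Fin using (Fin)
open import Data.Bool using (Bool; true; false; T; if_then_else_)
open import Data.Nat.ListAction using (sum)
open import Data.List using (List; []; _∷_; map; allFin; head; last; length)
open import Data.List.Membership.Propositional using (_∈_)
open import Data.List.Relation.Unary.Unique.Propositional using (Unique)
open import Data.Maybe using (Maybe; just)
open import Data.Product using (Σ; _×_; _,_)
open import Data.Sum using (_⊎_)
open import Data.Unit using (⊤)
open import Data.Empty using (⊥)
open import Relation.Nullary using (¬_)
open import Relation.Binary.PropositionalEquality using (_≡_; _≢_)

module Graph {V : ℕ} (adj : Fin V → Fin V → Bool) where

  deg : Fin V → ℕ
  deg v = sum (map (λ w → if adj v w then 1 else 0) (allFin V))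

  Chain : List (Fin V) → Set
  Chain []           = ⊤
  Chain (x ∷ [])     = ⊤
  Chain (x ∷ y ∷ r)  = T (adj x y) × Chain (y ∷ r)

  PathIn : Fin V → Fin V → List (Fin V) → Set
  PathIn u v ps = head ps ≡ just u × last ps ≡ just v × Chain ps × Unique ps

  Connected : Set
  Connected = ∀ u v → Σ (List (Fin V)) λ ps → PathIn u v ps

  IsCycle : List (Fin V) → Set
  IsCycle ps = 3 ≤ length ps × Chain ps × Unique ps ×
               Σ (Fin V) λ a → Σ (Fin V) λ b →
                 head ps ≡ just a × last ps ≡ just b × T (adj b a)

  Acyclic : Set
  Acyclic = ∀ ps → ¬ IsCycle ps

record PhyloTree (N : ℕ) : Set where
  field
    V        : ℕ
    adj      : Fin V → Fin V → Bool
    adj-sym  : ∀ u v → adj u v ≡ adj v u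
    adj-irr  : ∀ v → adj v v ≡ false
  open Graph adj public
  field
    connected : Connected
    acyclic   : Acyclic
    leaf      : Fin N → Fin V
    leaf-inj  : ∀ x y → leaf x ≡ leaf y → x ≡ y
    leaf-isLeaf : ∀ x → deg (leaf x) ≤ 1
    leaf-onto   : ∀ v → deg v ≤ 1 → Σ (Fin N) λ x → leaf x ≡ v
    inner-deg3  : ∀ v → ¬ (deg v ≤ 1) → deg v ≡ 3

-- Minimal subtree T[S] and restriction T|S (suppression of degree-2
-- vertices), for a subset S of X given as a predicate.

module Restrict {N : ℕ} (Tr : PhyloTree N) (S : Fin N → Set) where
  open PhyloTree Tr

  InSub : Fin V → Set
  InSub v = Σ (Fin N) λ a → Σ (Fin N) λ b → S a × S b ×
            Σ (List (Fin V)) λ ps → PathIn (leaf a) (leaf b) ps × v ∈ ps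

  Deg2Sub : Fin V → Set
  Deg2Sub v = Σ (Fin V) λ u → Σ (Fin V) λ w → u ≢ w ×
              T (adj v u) × T (adj v w) × InSub u × InSub w ×
              (∀ z → T (adj v z) → InSub z → z ≡ u ⊎ z ≡ w)

  -- vertices of T|S: vertices of T[S] that are not suppressed
  Kept : Fin V → Set
  Kept v = InSub v × ¬ Deg2Sub v

  -- adjacency in T|S: the path between u and v in T passes only through
  -- suppressed vertices
  SupAdj : Fin V → Fin V → Set
  SupAdj u v = u ≢ v × Σ (List (Fin V)) λ ps → PathIn u v ps ×
               (∀ z → z ∈ ps → z ≢ u → z ≢ v → ¬ Kept z)

-- T₁|S = T₂|S : a label-preserving isomorphism between the restrictions
record RestrEq {N : ℕ} (T₁ T₂ : PhyloTree N) (S : Fin N → Set) : Set where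
  module R₁ = Restrict T₁ S
  module R₂ = Restrict T₂ S
  open PhyloTree T₁ using () renaming (V to V₁; leaf to leaf₁)
  open PhyloTree T₂ using () renaming (V to V₂; leaf to leaf₂)
  field
    f      : Fin V₁ → Fin V₂
    g      : Fin V₂ → Fin V₁
    f-kept : ∀ u → R₁.Kept u → R₂.Kept (f u)
    g-kept : ∀ v → R₂.Kept v → R₁.Kept (g v)
    gf     : ∀ u → R₁.Kept u → g (f u) ≡ u
    fg     : ∀ v → R₂.Kept v → f (g v) ≡ v
    label  : ∀ x → S x → f (leaf₁ x) ≡ leaf₂ x
    adj→   : ∀ u v → R₁.Kept u → R₁.Kept v → R₁.SupAdj u v → R₂.SupAdj (f u) (f v)
    adj←   : ∀ u v → R₁.Kept u → R₁.Kept v → R₂.SupAdj (f u) (f v) → R₁.SupAdj u v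

-- (Relaxed) agreement forests with k blocks: a partition of X into k
-- nonempty blocks S_i = { x | block x ≡ i }, i.e. a surjection X → Fin k.

Block : {N k : ℕ} → (Fin N → Fin k) → Fin k → Fin N → Set
Block blk i x = blk x ≡ i

IsRAF : {N : ℕ} → PhyloTree N → PhyloTree N → (k : ℕ) → (Fin N → Fin k) → Set
IsRAF T₁ T₂ k blk =
  (∀ i → Σ _ λ x → blk x ≡ i) ×
  (∀ i → RestrEq T₁ T₂ (Block blk i))

IsAF : {N : ℕ} → PhyloTree N → PhyloTree N → (k : ℕ) → (Fin N → Fin k) → Set
IsAF T₁ T₂ k blk =
  IsRAF T₁ T₂ k blk ×
  (∀ i j → i ≢ j → ∀ v →
     Restrict.InSub T₁ (Block blk i) v → Restrict.InSub T₁ (Block blk j) v → ⊥) ×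
  (∀ i j → i ≢ j → ∀ v →
     Restrict.InSub T₂ (Block blk i) v → Restrict.InSub T₂ (Block blk j) v → ⊥)

HasRAF HasAF : {N : ℕ} → PhyloTree N → PhyloTree N → ℕ → Set
HasRAF T₁ T₂ k = Σ (Fin _ → Fin k) λ blk → IsRAF T₁ T₂ k blk
HasAF  T₁ T₂ k = Σ (Fin _ → Fin k) λ blk → IsAF T₁ T₂ k blk

-- T₁ and T₂ are caterpillars of m + 1 quartet gadgets; in T₁ each gadget has the quartet
-- ab|cd, and T₂ relabels T₁ by exchanging b and c, giving ac|bd. Putting all b's and c's in one
-- block and all other labels in the other yields a relaxed agreement forest of size 2: on the
-- first block the trees differ by the automorphism exchanging the two forks of every gadget, on
-- the second they coincide. In an agreement forest the subtrees spanned by distinct blocks are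
-- disjoint, so two sibling leaves lie in the same block unless one of them is a singleton. If no
-- label of a gadget were a singleton, its four labels would thus share one block S, which is
-- impossible because T₁|S and T₂|S display different quartets. Hence each gadget contributes its
-- own singleton block, and every agreement forest has at least m + 1 ≥ N / 6 blocks.

module Submission where

open import Defs
open import Data.Bool using (Bool; true; false; T; if_then_else_)
open import Data.Empty using (⊥; ⊥-elim)
open import Data.Fin using (Fin; zero; suc; fromℕ; inject₁; toℕ; _↑ʳ_)
open import Data.Fin.Patterns using (0F; 1F; 2F; 3F; 4F; 5F; 6F; 7F)
open import Data.Fin.Properties
  using (_≟_; ¬∀⟶∃¬; injective⇒≤; all?; any?; +↔⊎; *↔×; toℕ-fromℕ; toℕ-inject₁)
open import Data.List using (List; []; _∷_; map; allFin; head; last; length; _++_)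
import Data.List.Membership.DecPropositional as DecMembership
open import Data.List.Membership.Propositional using (_∈_; _∉_)
open import Data.List.Membership.Propositional.Properties using (∈-allFin; ∈-map⁺; ∈-map⁻)
open import Data.List.Properties using (map-cong; head-map; last-map; length-map)
open import Data.List.Relation.Unary.All using ([]; _∷_)
open import Data.List.Relation.Unary.All.Properties using (All¬⇒¬Any; ¬Any⇒All¬)
open import Data.List.Relation.Unary.AllPairs using ([]; _∷_)
open import Data.List.Relation.Unary.Any using (here; there)
open import Data.List.Relation.Unary.Unique.Propositional using (Unique)
open import Data.List.Relation.Unary.Unique.Propositional.Properties using (allFin⁺; map⁺)
open import Data.Maybe as Maybe using (just)
open import Data.Maybe.Properties using (just-injective)
open import Data.Nat using (ℕ; zero; suc; _+_; _*_; _≤_; _<_; s≤s; z≤n)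
open import Data.Nat.ListAction using (sum)
open import Data.Nat.Properties
  using (+-commutativeSemigroup; +-monoʳ-≤; *-monoʳ-≤; *-monoˡ-≤; *-comm; m≤m*n; m≤n+m; m≢1+n+m; 1+n≢n;
         suc-injective; ≤-refl; ≤-reflexive; ≤-trans; <-trans; <-irrefl; module ≤-Reasoning)
open import Data.Product using (Σ; _×_; _,_; proj₁; proj₂)
open import Data.Product.Properties using () renaming (≡-dec to ≡-dec-×)
open import Data.Sum as Sum using (_⊎_; inj₁; inj₂)
open import Data.Sum.Function.Propositional using (_⊎-↔_)
open import Data.Sum.Properties using () renaming (≡-dec to ≡-dec-⊎)
open import Data.Unit using (⊤; tt)
open import Function using (_∘_; id)
open import Function.Bundles using (_↔_; Inverse; Injection; mk⇔)
open import Function.Properties.Inverse using (↔-refl; ↔-sym; ↔-trans; Inverse⇒Injection)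
open import Relation.Binary using (DecidableEquality)
open import Relation.Binary.PropositionalEquality
  using (_≡_; _≢_; refl; sym; trans; cong; cong₂; subst; subst₂; module ≡-Reasoning)
open import Relation.Nullary using (¬_; Dec; yes; no; does)
open import Relation.Nullary.Decidable
  using (⌊_⌋; _→-dec_; dec-false; does-⇔; isYes≗does; toWitness; fromWitness)
open import Relation.Unary using (Decidable)

open import Algebra.Properties.CommutativeSemigroup +-commutativeSemigroup
  using () renaming (interchange to +-interchange)

variable
  n N : ℕ
  T₁ T₂ : PhyloTree N
  S : Fin N → Set

head-++ : {A : Set} (xs : List A) {ys : List A} {a : A} → head xs ≡ just a → head (xs ++ ys) ≡ just a
head-++ (x ∷ xs) h = h

last-++ : {A : Set} (xs ys : List A) {a : A} → last ys ≡ just a → last (xs ++ ys) ≡ just a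
last-++ []            ys       l = l
last-++ (x ∷ [])      (y ∷ ys) l = l
last-++ (x ∷ x′ ∷ xs) (y ∷ ys) l = last-++ (x′ ∷ xs) (y ∷ ys) l

last∈ : {A : Set} (x : A) (xs : List A) {ℓ : A} → last (x ∷ xs) ≡ just ℓ → ℓ ∈ x ∷ xs
last∈ x []       l = here (sym (just-injective l))
last∈ x (y ∷ xs) l = there (last∈ y xs l)

head∉tail : {A : Set} {x : A} {xs : List A} → Unique (x ∷ xs) → x ∉ xs
head∉tail (x∉ ∷ _) = All¬⇒¬Any x∉

sum-map-+ : {A : Set} (f g : A → ℕ) (xs : List A) →
            sum (map (λ x → f x + g x) xs) ≡ sum (map f xs) + sum (map g xs)
sum-map-+ f g []       = refl
sum-map-+ f g (x ∷ xs) rewrite sum-map-+ f g xs = +-interchange (f x) (g x) _ _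

indicator : Fin n → Fin n → ℕ
indicator y w = if does (w ≟ y) then 1 else 0

indicator-sym : ∀ (y w : Fin n) → indicator y w ≡ indicator w y
indicator-sym y w = cong (if_then 1 else 0) (does-⇔ (mk⇔ sym sym) (w ≟ y) (y ≟ w))

occurrences : List (Fin n) → Fin n → ℕ
occurrences ys w = sum (map (λ y → indicator y w) ys)

occurrences-∉ : ∀ ys {w : Fin n} → w ∉ ys → occurrences ys w ≡ 0
occurrences-∉ []       _  = refl
occurrences-∉ (y ∷ ys) {w} w∉ with w ≟ y
... | yes refl = ⊥-elim (w∉ (here refl))
... | no  _    = occurrences-∉ ys (w∉ ∘ there)

occurrences-∈ : ∀ {ys} {w : Fin n} → Unique ys → w ∈ ys → occurrences ys w ≡ 1
occurrences-∈ {ys = y ∷ ys} {w} u@(_ ∷ u′) w∈ with w ≟ y | w∈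
... | yes refl | _         = cong suc (occurrences-∉ ys (head∉tail u))
... | no  w≢y  | here w≡y  = ⊥-elim (w≢y w≡y)
... | no  _    | there w∈′ = occurrences-∈ u′ w∈′

sum-occurrences : ∀ (ys : List (Fin n)) → sum (map (occurrences ys) (allFin n)) ≡ length ys
sum-occurrences {n} []       = sum-zeros (allFin n)
  where
  sum-zeros : ∀ xs → sum (map (occurrences []) xs) ≡ 0
  sum-zeros []       = refl
  sum-zeros (_ ∷ xs) = sum-zeros xs
sum-occurrences {n} (y ∷ ys) = begin
  sum (map (λ w → indicator y w + occurrences ys w) (allFin n))
    ≡⟨ sum-map-+ (indicator y) (occurrences ys) (allFin n) ⟩
  sum (map (indicator y) (allFin n)) + sum (map (occurrences ys) (allFin n))
    ≡⟨ cong₂ _+_ each-once (sum-occurrences ys) ⟩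
  suc (length ys)
    ∎
  where
  open ≡-Reasoning
  each-once : sum (map (indicator y) (allFin n)) ≡ 1
  each-once = trans (cong sum (map-cong (indicator-sym y) (allFin n))) (occurrences-∈ (allFin⁺ n) (∈-allFin y))

module _ (adj : Fin n → Fin n → Bool) where
  open Graph adj

  deg≡length : ∀ v (ns : List (Fin n)) → Unique ns →
               (∀ w → T (adj v w) → w ∈ ns) → (∀ w → w ∈ ns → T (adj v w)) → deg v ≡ length ns
  deg≡length v ns u complete sound =
    trans (cong sum (map-cong pointwise (allFin n))) (sum-occurrences ns)
    where
    pointwise : ∀ w → (if adj v w then 1 else 0) ≡ occurrences ns w
    pointwise w with adj v w in eq
    ... | true  = sym (occurrences-∈ u (complete w (subst T (sym eq) tt)))
    ... | false = sym (occurrences-∉ ns (λ w∈ → subst T eq (sound w w∈)))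

  chain-tail : ∀ x r → Chain (x ∷ r) → Chain r
  chain-tail x []      _       = tt
  chain-tail x (y ∷ r) (_ , c) = c

  ExitsVia : (Fin n → Set) → Fin n → Set
  ExitsVia G e = ∀ x y → G x → ¬ G y → T (adj x y) → y ≡ e

  module _ {G : Fin n → Set} (G? : Decidable G) {e : Fin n} (exits : ExitsVia G e) where

    chain-exit : ∀ x r {v} → Chain (x ∷ r) → last (x ∷ r) ≡ just v → G x → ¬ G v → e ∈ x ∷ r
    chain-exit x []      _ refl Gx ¬Gv = ⊥-elim (¬Gv Gx)
    chain-exit x (y ∷ r) (xy , c) l Gx ¬Gv with G? y
    ... | yes Gy = there (chain-exit y r c l Gy ¬Gv)
    ... | no ¬Gy = there (here (sym (exits x y Gx ¬Gy xy)))

    path-exit : ∀ {u v ps} → PathIn u v ps → G u → ¬ G v → e ∈ ps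
    path-exit {ps = x ∷ r} (refl , l , c , _) = chain-exit x r c l

  PendantAt : Fin n → Fin n → Set
  PendantAt x p = T (adj x p) × (∀ y → T (adj x y) → y ≡ p)

  pendant-exits : ∀ {x p} → PendantAt x p → ExitsVia (_≡ x) p
  pendant-exits (_ , only-p) _ y refl _ xy = only-p y xy

  -- Consecutive vertices of a walk may coincide, so that walks can be glued at a common endpoint.
  Walk : List (Fin n) → Set
  Walk []          = ⊤
  Walk (x ∷ [])    = ⊤
  Walk (x ∷ y ∷ r) = (x ≡ y ⊎ T (adj x y)) × Walk (y ∷ r)

  walk-++ : ∀ xs ys {a b} → Walk xs → Walk ys → last xs ≡ just a → head ys ≡ just b →
            (a ≡ b ⊎ T (adj a b)) → Walk (xs ++ ys)
  walk-++ (x ∷ [])     (y ∷ ys) _        wys refl refl ab = ab , wys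
  walk-++ (x ∷ x′ ∷ xs) ys      (p , wxs) wys l    h    ab = p , walk-++ (x′ ∷ xs) ys wxs wys l h ab

  path-suffix : ∀ ps {x v} → x ∈ ps → Chain ps → Unique ps → last ps ≡ just v →
                Σ (List (Fin n)) (PathIn x v)
  path-suffix (p ∷ ps)     (here refl) c u l = p ∷ ps , refl , l , c , u
  path-suffix (p ∷ q ∷ ps) (there x∈)  c (_ ∷ u) l = path-suffix (q ∷ ps) x∈ (chain-tail p (q ∷ ps) c) u l

  walk⇒path : ∀ ws {u v} → Walk ws → head ws ≡ just u → last ws ≡ just v → Σ (List (Fin n)) (PathIn u v)
  walk⇒path (x ∷ [])    _       refl refl = x ∷ [] , refl , refl , tt , [] ∷ []
  walk⇒path (x ∷ y ∷ r) (p , w) refl l with walk⇒path (y ∷ r) w refl l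
  ... | ps , h , l′ , c , u with DecMembership._∈?_ _≟_ x ps
  ...   | yes x∈ = path-suffix ps x∈ c u l′
  walk⇒path (x ∷ y ∷ r) (inj₁ refl , w) refl l | y ∷ ps , refl , l′ , c , u | no x∉ = ⊥-elim (x∉ (here refl))
  walk⇒path (x ∷ y ∷ r) (inj₂ xy   , w) refl l | y ∷ ps , refl , l′ , c , u | no x∉ =
    x ∷ y ∷ ps , refl , l′ , (xy , c) , ¬Any⇒All¬ _ x∉ ∷ u

  module Rooted (adj-sym : ∀ u v → adj u v ≡ adj v u)
                (root : Fin n) (parent : Fin n → Fin n) (depth : Fin n → ℕ)
                (parent-root : parent root ≡ root)
                (depth-root : depth root ≡ 0)
                (depth≡0⇒root : ∀ v → depth v ≡ 0 → v ≡ root)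
                (depth-parent : ∀ v → v ≢ root → suc (depth (parent v)) ≡ depth v)
                (adj-parent : ∀ v → v ≢ root → T (adj v (parent v)))
                (edge-parent : ∀ u v → T (adj u v) → u ≡ parent v ⊎ v ≡ parent u) where

    depth-suc⇒≢root : ∀ v {r} → depth v ≡ suc r → v ≢ root
    depth-suc⇒≢root v d refl with trans (sym d) depth-root
    ... | ()

    ascent : ℕ → Fin n → List (Fin n)
    ascent zero    v = v ∷ []
    ascent (suc r) v = v ∷ ascent r (parent v)

    descent : ℕ → Fin n → List (Fin n)
    descent zero    v = v ∷ []
    descent (suc r) v = descent r (parent v) ++ (v ∷ [])

    depth-pred : ∀ v {r} → depth v ≡ suc r → depth (parent v) ≡ r
    depth-pred v d = suc-injective (trans (depth-parent v (depth-suc⇒≢root v d)) d)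

    ascent-walk : ∀ r v → depth v ≡ r →
                  Walk (ascent r v) × head (ascent r v) ≡ just v × last (ascent r v) ≡ just root
    ascent-walk zero v d rewrite depth≡0⇒root v d = tt , refl , refl
    ascent-walk (suc r) v d with ascent-walk r (parent v) (depth-pred v d)
    ... | w , h , l = walk-++ (v ∷ []) (ascent r (parent v)) tt w refl h (inj₂ (adj-parent v (depth-suc⇒≢root v d)))
                    , refl , last-++ (v ∷ []) (ascent r (parent v)) l

    descent-walk : ∀ r v → depth v ≡ r →
                   Walk (descent r v) × head (descent r v) ≡ just root × last (descent r v) ≡ just v
    descent-walk zero v d rewrite depth≡0⇒root v d = tt , refl , refl
    descent-walk (suc r) v d with descent-walk r (parent v) (depth-pred v d)
    ... | w , h , l = walk-++ (descent r (parent v)) (v ∷ []) w tt l refl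
                        (inj₂ (subst T (adj-sym v (parent v)) (adj-parent v (depth-suc⇒≢root v d))))
                    , head-++ (descent r (parent v)) h , last-++ (descent r (parent v)) (v ∷ []) refl

    connected : Connected
    connected u v with ascent-walk (depth u) u refl | descent-walk (depth v) v refl
    ... | w₁ , h₁ , l₁ | w₂ , h₂ , l₂ =
      walk⇒path (ascent (depth u) u ++ descent (depth v) v)
        (walk-++ (ascent (depth u) u) (descent (depth v) v) w₁ w₂ l₁ h₂ (inj₁ refl))
        (head-++ (ascent (depth u) u) h₁) (last-++ (ascent (depth u) u) (descent (depth v) v) l₂)

    parent-shallower : ∀ {x y} → x ≡ parent y → x ≢ y → depth x < depth y
    parent-shallower {y = y} refl py≢y with y ≟ root
    ... | yes refl = ⊥-elim (py≢y parent-root)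
    ... | no y≢root = subst (depth (parent y) <_) (depth-parent y y≢root) ≤-refl

    -- Along a simple chain, a step from a parent down to its child forces all later steps down.
    descending-chain : ∀ x y r {ℓ} → Unique (x ∷ y ∷ r) → Chain (x ∷ y ∷ r) → x ≡ parent y →
                       last (x ∷ y ∷ r) ≡ just ℓ → depth x < depth ℓ × parent ℓ ∈ x ∷ y ∷ r
    descending-chain x y [] u _ x≡py refl =
      parent-shallower x≡py (head∉tail u ∘ here) , here (sym x≡py)
    descending-chain x y (w ∷ r) u@(_ ∷ u′) (_ , yw , c) x≡py l with edge-parent y w yw
    ... | inj₂ w≡py = ⊥-elim (head∉tail u (there (here (trans x≡py (sym w≡py)))))
    ... | inj₁ y≡pw with descending-chain y w r u′ (yw , c) y≡pw l
    ...   | y<ℓ , pℓ∈ = <-trans (parent-shallower x≡py (head∉tail u ∘ here)) y<ℓ , there pℓ∈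

    -- Dually, a simple chain whose last vertex has its parent off the chain climbs all the way.
    ascending-chain : ∀ x y r {ℓ} → Unique (x ∷ y ∷ r) → Chain (x ∷ y ∷ r) →
                      last (x ∷ y ∷ r) ≡ just ℓ → parent ℓ ∉ x ∷ y ∷ r → depth ℓ < depth x × parent x ∈ y ∷ r
    ascending-chain x y [] u (xy , _) refl pℓ∉ with edge-parent x y xy
    ... | inj₁ x≡py = ⊥-elim (pℓ∉ (here (sym x≡py)))
    ... | inj₂ y≡px = parent-shallower y≡px (head∉tail u ∘ here ∘ sym) , here (sym y≡px)
    ascending-chain x y (w ∷ r) u@(_ ∷ u′) (xy , c) l pℓ∉
      with ascending-chain y w r u′ c l (pℓ∉ ∘ there) | edge-parent x y xy
    ... | _    , py∈ | inj₁ x≡py = ⊥-elim (head∉tail u (there (subst (_∈ w ∷ r) (sym x≡py) py∈)))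
    ... | ℓ<y , _    | inj₂ y≡px =
      <-trans ℓ<y (parent-shallower y≡px (head∉tail u ∘ here ∘ sym)) , here (sym y≡px)

    acyclic : Acyclic
    acyclic (x ∷ y ∷ w ∷ r) (_ , (xy , yw , c) , u@(_ ∷ u′) , _ , b , refl , lb , bx)
      with edge-parent x y xy | edge-parent b x bx
    ... | inj₂ y≡px | inj₁ b≡px = head∉tail u′ (subst (_∈ w ∷ r) (trans b≡px (sym y≡px)) (last∈ w r lb))
    ... | inj₂ y≡px | inj₂ x≡pb
      with ascending-chain y w r u′ (yw , c) lb (head∉tail u ∘ subst (_∈ y ∷ w ∷ r) (sym x≡pb))
    ...   | b<y , _ = <-irrefl refl (<-trans b<y (<-trans (parent-shallower y≡px (head∉tail u ∘ here ∘ sym))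
                                                          (parent-shallower x≡pb b≢x)))
      where b≢x : x ≢ b
            b≢x refl = head∉tail u (last∈ y (w ∷ r) lb)
    acyclic (x ∷ y ∷ w ∷ r) (_ , (xy , yw , c) , u@(_ ∷ u′) , _ , b , refl , lb , bx)
        | inj₁ x≡py | b≡px⊎x≡pb with edge-parent y w yw
    ... | inj₂ w≡py = head∉tail u (there (here (trans x≡py (sym w≡py))))
    ... | inj₁ y≡pw with descending-chain y w r u′ (yw , c) y≡pw lb | b≡px⊎x≡pb
    ...   | _   , pb∈ | inj₂ x≡pb = head∉tail u (subst (_∈ y ∷ w ∷ r) (sym x≡pb) pb∈)
    ...   | y<b , _   | inj₁ b≡px = <-irrefl refl (<-trans y<b (<-trans (parent-shallower b≡px b≢x)
                                                                        (parent-shallower x≡py (head∉tail u ∘ here))))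
      where b≢x : b ≢ x
            b≢x refl = head∉tail u (last∈ y (w ∷ r) lb)
    acyclic (_ ∷ [])     (s≤s () , _)
    acyclic (_ ∷ _ ∷ []) (s≤s (s≤s ()) , _)

-- Restrictions T|S

module _ (Tr : PhyloTree N) where
  open PhyloTree Tr

  adj⇒≢ : ∀ {u v} → T (adj u v) → u ≢ v
  adj⇒≢ {u} uv refl = subst T (adj-irr u) uv

  module _ (S : Fin N → Set) where
    open Restrict Tr S

    leaf∈sub : ∀ {x} → S x → InSub (leaf x)
    leaf∈sub {x} Sx = x , x , Sx , Sx , leaf x ∷ [] , (refl , refl , tt , [] ∷ []) , here refl

    exit∈sub : ∀ {G} → Decidable G → ∀ {e} → ExitsVia adj G e →
               ∀ {x y} → S x → S y → G (leaf x) → ¬ G (leaf y) → InSub e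
    exit∈sub G? exits {x} {y} Sx Sy Gx ¬Gy with connected (leaf x) (leaf y)
    ... | ps , path = x , y , Sx , Sy , ps , path , path-exit adj G? exits path Gx ¬Gy

    pendant∈sub : ∀ {x y p} → PendantAt adj (leaf x) p → S x → S y → x ≢ y → InSub p
    pendant∈sub {x} pendant Sx Sy x≢y =
      exit∈sub (_≟ leaf x) (pendant-exits adj pendant) Sx Sy refl (x≢y ∘ sym ∘ leaf-inj _ _)

    three-nbrs⇒kept : ∀ {v p q r} → InSub v → p ≢ q → p ≢ r → q ≢ r →
                      T (adj v p) → T (adj v q) → T (adj v r) → InSub p → InSub q → InSub r → Kept v
    three-nbrs⇒kept {v} {p} {q} {r} v∈ p≢q p≢r q≢r vp vq vr p∈ q∈ r∈ = v∈ , not-deg2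
      where
      not-deg2 : ¬ Deg2Sub v
      not-deg2 (_ , _ , _ , _ , _ , _ , _ , two) with two p vp p∈ | two q vq q∈ | two r vr r∈
      ... | inj₁ p≡ | inj₁ q≡ | _       = p≢q (trans p≡ (sym q≡))
      ... | inj₁ p≡ | inj₂ _  | inj₁ r≡ = p≢r (trans p≡ (sym r≡))
      ... | inj₁ _  | inj₂ q≡ | inj₂ r≡ = q≢r (trans q≡ (sym r≡))
      ... | inj₂ _  | inj₁ q≡ | inj₁ r≡ = q≢r (trans q≡ (sym r≡))
      ... | inj₂ p≡ | inj₁ _  | inj₂ r≡ = p≢r (trans p≡ (sym r≡))
      ... | inj₂ p≡ | inj₂ q≡ | _       = p≢q (trans p≡ (sym q≡))

    leaf-kept : ∀ {x p} → S x → PendantAt adj (leaf x) p → Kept (leaf x)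
    leaf-kept Sx (_ , only-p) =
      leaf∈sub Sx , λ (u , w , u≢w , xu , xw , _) → u≢w (trans (only-p u xu) (sym (only-p w xw)))

    edge⇒supAdj : ∀ {u v} → T (adj u v) → SupAdj u v
    edge⇒supAdj {u} {v} uv =
      adj⇒≢ uv , u ∷ v ∷ [] , (refl , refl , (uv , tt) , (adj⇒≢ uv ∷ []) ∷ [] ∷ []) , no-inner
      where
      no-inner : ∀ z → z ∈ u ∷ v ∷ [] → z ≢ u → z ≢ v → ¬ Kept z
      no-inner z (here refl)         z≢u _ = ⊥-elim (z≢u refl)
      no-inner z (there (here refl)) _ z≢v = ⊥-elim (z≢v refl)

    -- The parent u of a cherry {x, y} of T|S is not suppressed as soon as S has a label z beyond u.
    cherry-parent-kept : ∀ {G} → Decidable G → ∀ {u w} → ExitsVia adj G w → ¬ G w → T (adj u w) →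
                         ∀ {x y z} → S x → S y → S z → x ≢ y →
                         PendantAt adj (leaf x) u → PendantAt adj (leaf y) u →
                         G (leaf x) → G (leaf y) → ¬ G (leaf z) → Kept u
    cherry-parent-kept {G} G? exits ¬Gw uw Sx Sy Sz x≢y x-u@(xu , _) y-u@(yu , _) Gx Gy ¬Gz =
      three-nbrs⇒kept (pendant∈sub x-u Sx Sy x≢y)
        (x≢y ∘ leaf-inj _ _) (λ x≡w → ¬Gw (subst G x≡w Gx)) (λ y≡w → ¬Gw (subst G y≡w Gy))
        (subst T (adj-sym _ _) xu) (subst T (adj-sym _ _) yu) uw
        (leaf∈sub Sx) (leaf∈sub Sy) (exit∈sub G? exits Sx Sz Gx ¬Gz)

    pendant-supAdj : ∀ {x p} → PendantAt adj x p → Kept p → ∀ {w} → SupAdj x w → w ≡ p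
    pendant-supAdj {x} {p} pendant@(xp , _) p-kept {w} (x≢w , ps , path , inner) with w ≟ p
    ... | yes w≡p = w≡p
    ... | no w≢p = ⊥-elim (inner p (path-exit adj (_≟ x) (pendant-exits adj pendant) path refl (x≢w ∘ sym))
                             (adj⇒≢ xp ∘ sym) (w≢p ∘ sym) p-kept)

record IsoOn {N : ℕ} (T₁ T₂ : PhyloTree N) (S : Fin N → Set) : Set where
  module T₁ = PhyloTree T₁
  module T₂ = PhyloTree T₂
  field
    σ        : Fin T₁.V → Fin T₂.V
    τ        : Fin T₂.V → Fin T₁.V
    στ       : ∀ v → σ (τ v) ≡ v
    τσ       : ∀ v → τ (σ v) ≡ v
    adj-pres : ∀ u v → T₂.adj (σ u) (σ v) ≡ T₁.adj u v
    label    : ∀ x → S x → σ (T₁.leaf x) ≡ T₂.leaf x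

  σ-injective : ∀ {u v} → σ u ≡ σ v → u ≡ v
  σ-injective {u} {v} σu≡σv = trans (sym (τσ u)) (trans (cong τ σu≡σv) (τσ v))

  chain-map : ∀ ps → T₁.Chain ps → T₂.Chain (map σ ps)
  chain-map []          _        = tt
  chain-map (x ∷ [])    _        = tt
  chain-map (x ∷ y ∷ r) (xy , c) = subst T (sym (adj-pres x y)) xy , chain-map (y ∷ r) c

  path-map : ∀ {u v ps} → T₁.PathIn u v ps → T₂.PathIn (σ u) (σ v) (map σ ps)
  path-map {ps = ps} (h , l , c , u) =
    trans (head-map ps) (cong (Maybe.map σ) h) , trans (last-map σ ps) (cong (Maybe.map σ) l) ,
    chain-map ps c , map⁺ σ-injective u

IsoOn-sym : IsoOn T₁ T₂ S → IsoOn T₂ T₁ S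
IsoOn-sym {T₁ = T₁} {T₂} iso = record
  { σ = τ ; τ = σ ; στ = τσ ; τσ = στ
  ; adj-pres = λ u v → trans (sym (adj-pres (τ u) (τ v))) (cong₂ (PhyloTree.adj T₂) (στ u) (στ v))
  ; label = λ x Sx → trans (cong τ (sym (label x Sx))) (τσ _) }
  where open IsoOn iso

InSub-iso : (iso : IsoOn T₁ T₂ S) → let open IsoOn iso in
            ∀ v → Restrict.InSub T₁ S v → Restrict.InSub T₂ S (σ v)
InSub-iso iso v (a , b , Sa , Sb , ps , path , v∈) =
  a , b , Sa , Sb , map σ ps ,
  subst₂ (λ u w → T₂.PathIn u w (map σ ps)) (label a Sa) (label b Sb) (path-map path) ,
  ∈-map⁺ σ v∈
  where open IsoOn iso

Deg2Sub-iso : (iso : IsoOn T₁ T₂ S) → let open IsoOn iso in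
              ∀ v → Restrict.Deg2Sub T₁ S v → Restrict.Deg2Sub T₂ S (σ v)
Deg2Sub-iso {T₁ = T₁} {T₂} {S} iso v (u , w , u≢w , vu , vw , u∈ , w∈ , two) =
  σ u , σ w , u≢w ∘ σ-injective , subst T (sym (adj-pres v u)) vu , subst T (sym (adj-pres v w)) vw ,
  InSub-iso iso u u∈ , InSub-iso iso w w∈ , two′
  where
  open IsoOn iso
  two′ : ∀ z → T (T₂.adj (σ v) z) → Restrict.InSub T₂ S z → z ≡ σ u ⊎ z ≡ σ w
  two′ z vz z∈ with two (τ z) (subst T (trans (cong (T₂.adj (σ v)) (sym (στ z))) (adj-pres v (τ z))) vz)
                        (InSub-iso (IsoOn-sym iso) z z∈)
  ... | inj₁ τz≡u = inj₁ (trans (sym (στ z)) (cong σ τz≡u))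
  ... | inj₂ τz≡w = inj₂ (trans (sym (στ z)) (cong σ τz≡w))

Kept-iso : (iso : IsoOn T₁ T₂ S) → let open IsoOn iso in
           ∀ v → Restrict.Kept T₁ S v → Restrict.Kept T₂ S (σ v)
Kept-iso {T₁ = T₁} {S = S} iso v (v∈ , ¬deg2) =
  InSub-iso iso v v∈ , λ deg2 → ¬deg2 (subst (Restrict.Deg2Sub T₁ S) (τσ v) (Deg2Sub-iso (IsoOn-sym iso) (σ v) deg2))
  where open IsoOn iso

SupAdj-iso : (iso : IsoOn T₁ T₂ S) → let open IsoOn iso in
             ∀ u v → Restrict.SupAdj T₁ S u v → Restrict.SupAdj T₂ S (σ u) (σ v)
SupAdj-iso {T₁ = T₁} {T₂} {S} iso u v (u≢v , ps , path , inner) =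
  u≢v ∘ σ-injective , map σ ps , path-map path , inner′
  where
  open IsoOn iso
  inner′ : ∀ z → z ∈ map σ ps → z ≢ σ u → z ≢ σ v → ¬ Restrict.Kept T₂ S z
  inner′ z z∈ z≢σu z≢σv z-kept with ∈-map⁻ σ z∈
  ... | y , y∈ , refl = inner y y∈ (z≢σu ∘ cong σ) (z≢σv ∘ cong σ)
                          (subst (Restrict.Kept T₁ S) (τσ y) (Kept-iso (IsoOn-sym iso) (σ y) z-kept))

iso⇒RestrEq : IsoOn T₁ T₂ S → RestrEq T₁ T₂ S
iso⇒RestrEq {T₁ = T₁} {S = S} iso = record
  { f = σ ; g = τ
  ; f-kept = Kept-iso iso
  ; g-kept = Kept-iso (IsoOn-sym iso)
  ; gf = λ u _ → τσ u
  ; fg = λ v _ → στ v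
  ; label = label
  ; adj→ = λ u v _ _ → SupAdj-iso iso u v
  ; adj← = λ u v _ _ s → subst₂ (Restrict.SupAdj T₁ S) (τσ u) (τσ v) (SupAdj-iso (IsoOn-sym iso) (σ u) (σ v) s) }
  where open IsoOn iso

-- Cherries and agreement forests

cherry-parent-unique : RestrEq T₁ T₂ S → let module T₁ = PhyloTree T₁; module T₂ = PhyloTree T₂ in
  ∀ {x y u p q} → S x → S y →
  PendantAt T₁.adj (T₁.leaf x) u → PendantAt T₁.adj (T₁.leaf y) u → Restrict.Kept T₁ S u →
  PendantAt T₂.adj (T₂.leaf x) p → Restrict.Kept T₂ S p →
  PendantAt T₂.adj (T₂.leaf y) q → Restrict.Kept T₂ S q → p ≡ q
cherry-parent-unique {T₁ = T₁} {T₂} {S} re {x} {y} {u} Sx Sy x-u y-u u-kept x-p p-kept y-q q-kept =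
  trans (sym (image-of-parent Sx x-u x-p p-kept)) (image-of-parent Sy y-u y-q q-kept)
  where
  open RestrEq re
  image-of-parent : ∀ {z r} → S z → PendantAt (PhyloTree.adj T₁) (PhyloTree.leaf T₁ z) u →
                    PendantAt (PhyloTree.adj T₂) (PhyloTree.leaf T₂ z) r → Restrict.Kept T₂ S r → f u ≡ r
  image-of-parent Sz z-u z-r r-kept =
    pendant-supAdj T₂ S z-r r-kept
      (subst (λ w → Restrict.SupAdj T₂ S w (f u)) (label _ Sz)
        (adj→ _ u (leaf-kept T₁ S Sz z-u) u-kept (edge⇒supAdj T₁ S (proj₁ z-u))))

DisjointSubtrees : (Tr : PhyloTree N) {k : ℕ} → (Fin N → Fin k) → Set
DisjointSubtrees Tr blk = ∀ i j → i ≢ j → ∀ v →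
  Restrict.InSub Tr (Block blk i) v → Restrict.InSub Tr (Block blk j) v → ⊥

SharesBlock : {k : ℕ} → (Fin N → Fin k) → Fin N → Set
SharesBlock {N} blk x = Σ (Fin N) λ z → blk z ≡ blk x × z ≢ x

Singleton : {k : ℕ} → (Fin N → Fin k) → Fin N → Set
Singleton {N} blk x = ∀ (z : Fin N) → blk z ≡ blk x → z ≡ x

singleton? : ∀ {k} (blk : Fin N → Fin k) x → Dec (Singleton blk x)
singleton? blk x = all? (λ z → (blk z ≟ blk x) →-dec (z ≟ x))

¬singleton⇒sharesBlock : ∀ {k} (blk : Fin N → Fin k) x → ¬ Singleton blk x → SharesBlock blk x
¬singleton⇒sharesBlock {N} blk x ¬single with ¬∀⟶∃¬ N _ (λ z → (blk z ≟ blk x) →-dec (z ≟ x)) ¬single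
... | z , ¬implies with blk z ≟ blk x
...   | yes same = z , same , λ z≡x → ¬implies (λ _ → z≡x)
...   | no  diff = ⊥-elim (¬implies (λ same → ⊥-elim (diff same)))

singletons≤blocks : ∀ {k n} (blk : Fin N → Fin k) (f : Fin n → Fin N) →
                    (∀ {i j} → f i ≡ f j → i ≡ j) → (∀ i → Singleton blk (f i)) → n ≤ k
singletons≤blocks blk f f-injective single =
  injective⇒≤ (λ {i} {j} same → sym (f-injective (single i (f j) (sym same))))

siblings-same-block : (Tr : PhyloTree N) {k : ℕ} {blk : Fin N → Fin k} → DisjointSubtrees Tr blk →
  let open PhyloTree Tr in
  ∀ {x y p} → PendantAt adj (leaf x) p → PendantAt adj (leaf y) p →
  SharesBlock blk x → SharesBlock blk y → blk x ≡ blk y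
siblings-same-block Tr {blk = blk} disjoint {x} {y} x-p y-p (x′ , bx′ , x′≢x) (y′ , by′ , y′≢y)
  with blk x ≟ blk y
... | yes bx≡by = bx≡by
... | no bx≢by = ⊥-elim (disjoint (blk x) (blk y) bx≢by _
                   (pendant∈sub Tr (Block blk (blk x)) x-p refl bx′ (x′≢x ∘ sym))
                   (pendant∈sub Tr (Block blk (blk y)) y-p refl by′ (y′≢y ∘ sym)))

isYes-⇔ : {A B : Set} → (A → B) → (B → A) → (a? : Dec A) (b? : Dec B) → ⌊ a? ⌋ ≡ ⌊ b? ⌋
isYes-⇔ f g a? b? = trans (isYes≗does a?) (trans (does-⇔ (mk⇔ f g) a? b?) (sym (isYes≗does b?)))

module FromNeighbours {X : Set} (_≟X_ : DecidableEquality X) {V : ℕ} (vertex↔ : X ↔ Fin V)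
                      (nbrs : X → List X)
                      (nbrs-unique : ∀ x → Unique (nbrs x))
                      (nbrs-sym : ∀ x y → y ∈ nbrs x → x ∈ nbrs y)
                      (nbrs-irrefl : ∀ x → x ∉ nbrs x) where
  open Inverse vertex↔ public
    using () renaming (to to encode; from to decode; strictlyInverseˡ to encode-decode; strictlyInverseʳ to decode-encode)

  encode-injective : ∀ {x y} → encode x ≡ encode y → x ≡ y
  encode-injective = Injection.injective (Inverse⇒Injection vertex↔)

  decode≡⇒≡encode : ∀ {v x} → decode v ≡ x → v ≡ encode x
  decode≡⇒≡encode {v} refl = sym (encode-decode v)

  _∈X?_ : ∀ x ys → Dec (x ∈ ys)
  _∈X?_ = DecMembership._∈?_ _≟X_

  adjacent : Fin V → Fin V → Bool
  adjacent u v = ⌊ decode v ∈X? nbrs (decode u) ⌋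

  adjacent⇒∈ : ∀ {u v} → T (adjacent u v) → decode v ∈ nbrs (decode u)
  adjacent⇒∈ = toWitness

  ∈⇒adjacent : ∀ {x y} → y ∈ nbrs x → T (adjacent (encode x) (encode y))
  ∈⇒adjacent {x} {y} y∈ =
    fromWitness (subst₂ (λ a b → b ∈ nbrs a) (sym (decode-encode x)) (sym (decode-encode y)) y∈)

  adjacent-sym : ∀ u v → adjacent u v ≡ adjacent v u
  adjacent-sym u v = isYes-⇔ (nbrs-sym _ _) (nbrs-sym _ _) (_ ∈X? _) (_ ∈X? _)

  adjacent-irrefl : ∀ v → adjacent v v ≡ false
  adjacent-irrefl v = trans (isYes≗does (_ ∈X? _)) (dec-false (_ ∈X? _) (nbrs-irrefl (decode v)))

  deg-adjacent : ∀ v → Graph.deg adjacent v ≡ length (nbrs (decode v))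
  deg-adjacent v = trans (deg≡length adjacent v (map encode (nbrs (decode v))) (map⁺ encode-injective (nbrs-unique _))
                           complete sound)
                         (length-map encode (nbrs (decode v)))
    where
    complete : ∀ w → T (adjacent v w) → w ∈ map encode (nbrs (decode v))
    complete w vw = subst (_∈ map encode (nbrs (decode v))) (encode-decode w) (∈-map⁺ encode (adjacent⇒∈ vw))
    sound : ∀ w → w ∈ map encode (nbrs (decode v)) → T (adjacent v w)
    sound w w∈ with ∈-map⁻ encode w∈
    ... | y , y∈ , refl = subst (λ u → T (adjacent u (encode y))) (encode-decode v) (∈⇒adjacent y∈)

  pendant : ∀ {x p} → nbrs x ≡ p ∷ [] → PendantAt adjacent (encode x) (encode p)
  pendant {x} {p} nbrs≡ = ∈⇒adjacent (subst (p ∈_) (sym nbrs≡) (here refl)) , only-p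
    where
    only-p : ∀ w → T (adjacent (encode x) w) → w ≡ encode p
    only-p w xw with subst (λ ys → decode w ∈ ys) (trans (cong nbrs (decode-encode x)) nbrs≡) (adjacent⇒∈ xw)
    ... | here w≡p = decode≡⇒≡encode w≡p

  list-exits : (G : List X) (e : X) → (∀ x → x ∈ G → ∀ y → y ∈ nbrs x → y ∈ G ⊎ y ≡ e) →
               ExitsVia adjacent (λ v → decode v ∈ G) (encode e)
  list-exits G e closed u v u∈ v∉ uv with closed (decode u) u∈ (decode v) (adjacent⇒∈ uv)
  ... | inj₁ v∈ = ⊥-elim (v∉ v∈)
  ... | inj₂ v≡e = decode≡⇒≡encode v≡e

  automorphism-adjacent : (f : X → X) → (∀ x y → y ∈ nbrs x → f y ∈ nbrs (f x)) → (∀ x → f (f x) ≡ x) →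
                          ∀ u v → adjacent (encode (f (decode u))) (encode (f (decode v))) ≡ adjacent u v
  automorphism-adjacent f f-nbrs f-involutive u v
    rewrite decode-encode (f (decode u)) | decode-encode (f (decode v)) =
    isYes-⇔ (subst₂ (λ a b → b ∈ nbrs a) (f-involutive _) (f-involutive _) ∘ f-nbrs _ _) (f-nbrs _ _)
            (_ ∈X? _) (_ ∈X? _)

  module Build (root : X) (parent : X → X) (depth : X → ℕ)
               (parent-root : parent root ≡ root)
               (depth-root : depth root ≡ 0)
               (depth≡0⇒root : ∀ x → depth x ≡ 0 → x ≡ root)
               (depth-parent : ∀ x → x ≢ root → suc (depth (parent x)) ≡ depth x)
               (parent∈nbrs : ∀ x → x ≢ root → parent x ∈ nbrs x)
               (nbr-parent : ∀ x y → y ∈ nbrs x → x ≡ parent y ⊎ y ≡ parent x)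
               {L : Set} {N : ℕ} (label↔ : L ↔ Fin N) (leafAt : L → X)
               (leafAt-injective : ∀ {ℓ ℓ′} → leafAt ℓ ≡ leafAt ℓ′ → ℓ ≡ ℓ′)
               (leaf-degree : ∀ ℓ → length (nbrs (leafAt ℓ)) ≡ 1)
               (inner-or-leaf : ∀ x → length (nbrs x) ≡ 3 ⊎ Σ L λ ℓ → leafAt ℓ ≡ x) where
    open Inverse label↔ public using ()
      renaming (to to labelOf; from to labelled; strictlyInverseˡ to labelOf-labelled; strictlyInverseʳ to labelled-labelOf)

    labelOf-injective : ∀ {ℓ ℓ′} → labelOf ℓ ≡ labelOf ℓ′ → ℓ ≡ ℓ′
    labelOf-injective = Injection.injective (Inverse⇒Injection label↔)

    labelled-injective : ∀ {x y} → labelled x ≡ labelled y → x ≡ y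
    labelled-injective = Injection.injective (Inverse⇒Injection (↔-sym label↔))

    private
      encode-≢ : ∀ {v} → v ≢ encode root → decode v ≢ root
      encode-≢ v≢ = v≢ ∘ decode≡⇒≡encode

      module R = Rooted adjacent adjacent-sym (encode root) (encode ∘ parent ∘ decode) (depth ∘ decode)
        (trans (cong (encode ∘ parent) (decode-encode root)) (cong encode parent-root))
        (trans (cong depth (decode-encode root)) depth-root)
        (λ v d≡0 → decode≡⇒≡encode (depth≡0⇒root (decode v) d≡0))
        (λ v v≢ → trans (cong (suc ∘ depth) (decode-encode _)) (depth-parent (decode v) (encode-≢ v≢)))
        (λ v v≢ → subst (λ u → T (adjacent u (encode (parent (decode v))))) (encode-decode v)
                    (∈⇒adjacent (parent∈nbrs (decode v) (encode-≢ v≢))))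
        (λ u v uv → Sum.map decode≡⇒≡encode decode≡⇒≡encode (nbr-parent (decode u) (decode v) (adjacent⇒∈ uv)))

    leaf : Fin N → Fin V
    leaf = encode ∘ leafAt ∘ labelled

    degree-leaf : ∀ ℓ → Graph.deg adjacent (encode (leafAt ℓ)) ≡ 1
    degree-leaf ℓ = trans (deg-adjacent _) (trans (cong (length ∘ nbrs) (decode-encode _)) (leaf-degree ℓ))

    tree : PhyloTree N
    tree = record
      { V = V ; adj = adjacent ; adj-sym = adjacent-sym ; adj-irr = adjacent-irrefl
      ; connected = R.connected ; acyclic = R.acyclic
      ; leaf = leaf
      ; leaf-inj = λ x y eq → labelled-injective (leafAt-injective (encode-injective eq))
      ; leaf-isLeaf = λ x → ≤-reflexive (degree-leaf (labelled x))
      ; leaf-onto = onto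
      ; inner-deg3 = inner }
      where
      onto : ∀ v → Graph.deg adjacent v ≤ 1 → Σ (Fin N) λ x → leaf x ≡ v
      onto v d≤1 with inner-or-leaf (decode v)
      ... | inj₁ d≡3 = ⊥-elim (3≰1 (subst (_≤ 1) (trans (deg-adjacent v) d≡3) d≤1))
        where 3≰1 : ¬ 3 ≤ 1
              3≰1 (s≤s ())
      ... | inj₂ (ℓ , eq) = labelOf ℓ , trans (cong (encode ∘ leafAt) (labelled-labelOf ℓ))
                                             (trans (cong encode eq) (encode-decode v))
      inner : ∀ v → ¬ Graph.deg adjacent v ≤ 1 → Graph.deg adjacent v ≡ 3
      inner v d≰1 with inner-or-leaf (decode v)
      ... | inj₁ d≡3 = trans (deg-adjacent v) d≡3
      ... | inj₂ (ℓ , eq) = ⊥-elim (d≰1 (≤-reflexive (subst (λ u → Graph.deg adjacent u ≡ 1)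
                                                        (trans (cong encode eq) (encode-decode v)) (degree-leaf ℓ))))

relabel : (Tr : PhyloTree N) (π : Fin N → Fin N) → (∀ x → π (π x) ≡ x) → PhyloTree N
relabel Tr π π-involutive = record Tr
  { leaf        = leaf ∘ π
  ; leaf-inj    = λ x y eq → trans (sym (π-involutive x)) (trans (cong π (leaf-inj (π x) (π y) eq)) (π-involutive y))
  ; leaf-isLeaf = leaf-isLeaf ∘ π
  ; leaf-onto   = λ v d≤1 → let (x , eq) = leaf-onto v d≤1 in π x , trans (cong leaf (π-involutive x)) eq
  }
  where open PhyloTree Tr

-- The caterpillar of quartets

data LastOrInject₁ : {m : ℕ} → Fin (suc m) → Set where
  is-last    : ∀ {m} → LastOrInject₁ (fromℕ m)
  is-inject₁ : ∀ {m} (j : Fin m) → LastOrInject₁ (inject₁ j)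

lastOrInject₁ : ∀ {m} (i : Fin (suc m)) → LastOrInject₁ i
lastOrInject₁ {zero}  zero    = is-last
lastOrInject₁ {suc m} zero    = is-inject₁ zero
lastOrInject₁ {suc m} (suc i) with lastOrInject₁ i
... | is-last      = is-last
... | is-inject₁ j = is-inject₁ (suc j)

lastOrInject₁-fromℕ : ∀ m → lastOrInject₁ (fromℕ m) ≡ is-last
lastOrInject₁-fromℕ zero = refl
lastOrInject₁-fromℕ (suc m) rewrite lastOrInject₁-fromℕ m = refl

lastOrInject₁-inject₁ : ∀ {m} (j : Fin m) → lastOrInject₁ (inject₁ j) ≡ is-inject₁ j
lastOrInject₁-inject₁ {suc m} zero    = refl
lastOrInject₁-inject₁ {suc m} (suc j) rewrite lastOrInject₁-inject₁ j = refl

-- Two end leaves plus n gadgets of k vertices (or k labels) each.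

Gadgets : ℕ → ℕ → Set
Gadgets n k = Fin 2 ⊎ Fin n × Fin k

gadgets↔ : ∀ n k → Gadgets n k ↔ Fin (2 + n * k)
gadgets↔ n k = ↔-sym (↔-trans +↔⊎ (↔-refl ⊎-↔ *↔×))

_≟G_ : ∀ {n k} → DecidableEquality (Gadgets n k)
_≟G_ = ≡-dec-⊎ _≟_ (≡-dec-× _≟_ _≟_)

-- The spine is the path end₀ — spine 0 — ⋯ — spine m — end₁; gadget i hangs off spine i by the
-- edge to stem i, which forks into fork₁ i over the leaves A i, B i and fork₂ i over C i, D i.

pattern end₀    = inj₁ 0F
pattern end₁    = inj₁ 1F
pattern spine i = inj₂ (i , 0F)
pattern stem  i = inj₂ (i , 1F)
pattern fork₁ i = inj₂ (i , 2F)
pattern fork₂ i = inj₂ (i , 3F)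
pattern A i     = inj₂ (i , 4F)
pattern B i     = inj₂ (i , 5F)
pattern C i     = inj₂ (i , 6F)
pattern D i     = inj₂ (i , 7F)

module Caterpillar (m : ℕ) where

  Vertex : Set
  Vertex = Gadgets (suc m) 8

  #vertices : ℕ
  #vertices = 2 + suc m * 8

  prev : Fin (suc m) → Vertex
  prev zero    = end₀
  prev (suc j) = spine (inject₁ j)

  next-of : {i : Fin (suc m)} → LastOrInject₁ i → Vertex
  next-of is-last        = end₁
  next-of (is-inject₁ j) = spine (suc j)

  next : Fin (suc m) → Vertex
  next i = next-of (lastOrInject₁ i)

  nbrs : Vertex → List Vertex
  nbrs end₀      = spine zero ∷ []
  nbrs end₁      = spine (fromℕ m) ∷ []
  nbrs (spine i) = prev i ∷ next i ∷ stem i ∷ []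
  nbrs (stem i)  = spine i ∷ fork₁ i ∷ fork₂ i ∷ []
  nbrs (fork₁ i) = stem i ∷ A i ∷ B i ∷ []
  nbrs (fork₂ i) = stem i ∷ C i ∷ D i ∷ []
  nbrs (A i)     = fork₁ i ∷ []
  nbrs (B i)     = fork₁ i ∷ []
  nbrs (C i)     = fork₂ i ∷ []
  nbrs (D i)     = fork₂ i ∷ []

  parent : Vertex → Vertex
  parent end₀      = end₀
  parent end₁      = spine (fromℕ m)
  parent (spine i) = prev i
  parent (stem i)  = spine i
  parent (fork₁ i) = stem i
  parent (fork₂ i) = stem i
  parent (A i)     = fork₁ i
  parent (B i)     = fork₁ i
  parent (C i)     = fork₂ i
  parent (D i)     = fork₂ i

  height : Fin 8 → ℕ
  height 0F = 0
  height 1F = 1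
  height 2F = 2
  height 3F = 2
  height _  = 3

  depth : Vertex → ℕ
  depth end₀           = 0
  depth end₁           = 2 + m
  depth (inj₂ (i , k)) = suc (height k + toℕ i)

  depth-prev : ∀ i → depth (prev i) ≡ toℕ i
  depth-prev zero    = refl
  depth-prev (suc j) = cong suc (toℕ-inject₁ j)

  depth-next : ∀ i → depth (next i) ≡ 2 + toℕ i
  depth-next i with lastOrInject₁ i
  ... | is-last      = cong (2 +_) (sym (toℕ-fromℕ m))
  ... | is-inject₁ j = cong (2 +_) (sym (toℕ-inject₁ j))

  ≢-by-depth : ∀ {x y} → depth x ≢ depth y → x ≢ y
  ≢-by-depth d≢ refl = d≢ refl

  next≢stem : ∀ i j → next i ≢ stem j
  next≢stem i j with lastOrInject₁ i
  ... | is-last      = λ ()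
  ... | is-inject₁ _ = λ ()

  prev≢stem : ∀ i j → prev i ≢ stem j
  prev≢stem zero    _ ()
  prev≢stem (suc _) _ ()

  nbrs-unique : ∀ x → Unique (nbrs x)
  nbrs-unique end₀      = [] ∷ []
  nbrs-unique end₁      = [] ∷ []
  nbrs-unique (spine i) =
    (prev≢next ∷ prev≢stem i i ∷ []) ∷ (next≢stem i i ∷ []) ∷ [] ∷ []
    where
    prev≢next : prev i ≢ next i
    prev≢next = ≢-by-depth (λ eq → m≢1+n+m (toℕ i) {1} (trans (sym (depth-prev i)) (trans eq (depth-next i))))
  nbrs-unique (stem i)  = ((λ ()) ∷ (λ ()) ∷ []) ∷ ((λ ()) ∷ []) ∷ [] ∷ []
  nbrs-unique (fork₁ i) = ((λ ()) ∷ (λ ()) ∷ []) ∷ ((λ ()) ∷ []) ∷ [] ∷ []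
  nbrs-unique (fork₂ i) = ((λ ()) ∷ (λ ()) ∷ []) ∷ ((λ ()) ∷ []) ∷ [] ∷ []
  nbrs-unique (A i)     = [] ∷ []
  nbrs-unique (B i)     = [] ∷ []
  nbrs-unique (C i)     = [] ∷ []
  nbrs-unique (D i)     = [] ∷ []

  nbrs-irrefl : ∀ x → x ∉ nbrs x
  nbrs-irrefl end₀      (here ())
  nbrs-irrefl end₁      (here ())
  nbrs-irrefl (spine i) (here eq)                 = ≢-by-depth (λ d≡ → 1+n≢n (trans d≡ (depth-prev i))) eq
  nbrs-irrefl (spine i) (there (here eq))         = ≢-by-depth (λ d≡ → 1+n≢n (sym (trans d≡ (depth-next i)))) eq
  nbrs-irrefl (spine i) (there (there (here ())))
  nbrs-irrefl (stem i)  (here ())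
  nbrs-irrefl (stem i)  (there (here ()))
  nbrs-irrefl (stem i)  (there (there (here ())))
  nbrs-irrefl (fork₁ i) (here ())
  nbrs-irrefl (fork₁ i) (there (here ()))
  nbrs-irrefl (fork₁ i) (there (there (here ())))
  nbrs-irrefl (fork₂ i) (here ())
  nbrs-irrefl (fork₂ i) (there (here ()))
  nbrs-irrefl (fork₂ i) (there (there (here ())))
  nbrs-irrefl (A i)     (here ())
  nbrs-irrefl (B i)     (here ())
  nbrs-irrefl (C i)     (here ())
  nbrs-irrefl (D i)     (here ())

  next-fromℕ : next (fromℕ m) ≡ end₁
  next-fromℕ rewrite lastOrInject₁-fromℕ m = refl

  next-inject₁ : ∀ j → next (inject₁ j) ≡ spine (suc j)
  next-inject₁ j rewrite lastOrInject₁-inject₁ j = refl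

  nbrs-sym : ∀ x y → y ∈ nbrs x → x ∈ nbrs y
  nbrs-sym end₀            _ (here refl) = here refl
  nbrs-sym end₁            _ (here refl) = there (here (sym next-fromℕ))
  nbrs-sym (spine zero)    _ (here refl) = here refl
  nbrs-sym (spine (suc j)) _ (here refl) = there (here (sym (next-inject₁ j)))
  nbrs-sym (spine i)       _ (there (here refl)) with lastOrInject₁ i
  ... | is-last      = here refl
  ... | is-inject₁ j = here refl
  nbrs-sym (spine i) _ (there (there (here refl)))         = here refl
  nbrs-sym (stem i)  _ (here refl)                         = there (there (here refl))
  nbrs-sym (stem i)  _ (there (here refl))                 = here refl
  nbrs-sym (stem i)  _ (there (there (here refl)))         = here refl
  nbrs-sym (fork₁ i) _ (here refl)                         = there (here refl)
  nbrs-sym (fork₁ i) _ (there (here refl))                 = here refl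
  nbrs-sym (fork₁ i) _ (there (there (here refl)))         = here refl
  nbrs-sym (fork₂ i) _ (here refl)                         = there (there (here refl))
  nbrs-sym (fork₂ i) _ (there (here refl))                 = here refl
  nbrs-sym (fork₂ i) _ (there (there (here refl)))         = here refl
  nbrs-sym (A i)     _ (here refl)                         = there (here refl)
  nbrs-sym (B i)     _ (here refl)                         = there (there (here refl))
  nbrs-sym (C i)     _ (here refl)                         = there (here refl)
  nbrs-sym (D i)     _ (here refl)                         = there (there (here refl))

  nbr-parent : ∀ x y → y ∈ nbrs x → x ≡ parent y ⊎ y ≡ parent x
  nbr-parent (spine i) _ (there (here refl)) with lastOrInject₁ i
  ... | is-last      = inj₁ refl
  ... | is-inject₁ j = inj₁ refl
  nbr-parent end₀      _ (here refl)                 = inj₁ refl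
  nbr-parent end₁      _ (here refl)                 = inj₂ refl
  nbr-parent (spine i) _ (here refl)                 = inj₂ refl
  nbr-parent (spine i) _ (there (there (here refl))) = inj₁ refl
  nbr-parent (stem i)  _ (here refl)                 = inj₂ refl
  nbr-parent (stem i)  _ (there (here refl))         = inj₁ refl
  nbr-parent (stem i)  _ (there (there (here refl))) = inj₁ refl
  nbr-parent (fork₁ i) _ (here refl)                 = inj₂ refl
  nbr-parent (fork₁ i) _ (there (here refl))         = inj₁ refl
  nbr-parent (fork₁ i) _ (there (there (here refl))) = inj₁ refl
  nbr-parent (fork₂ i) _ (here refl)                 = inj₂ refl
  nbr-parent (fork₂ i) _ (there (here refl))         = inj₁ refl
  nbr-parent (fork₂ i) _ (there (there (here refl))) = inj₁ refl
  nbr-parent (A i)     _ (here refl)                 = inj₂ refl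
  nbr-parent (B i)     _ (here refl)                 = inj₂ refl
  nbr-parent (C i)     _ (here refl)                 = inj₂ refl
  nbr-parent (D i)     _ (here refl)                 = inj₂ refl

  parent∈nbrs : ∀ x → x ≢ end₀ → parent x ∈ nbrs x
  parent∈nbrs end₀ x≢ = ⊥-elim (x≢ refl)
  parent∈nbrs end₁ _ = here refl
  parent∈nbrs (spine i) _ = here refl
  parent∈nbrs (stem i)  _ = here refl
  parent∈nbrs (fork₁ i) _ = here refl
  parent∈nbrs (fork₂ i) _ = here refl
  parent∈nbrs (A i)     _ = here refl
  parent∈nbrs (B i)     _ = here refl
  parent∈nbrs (C i)     _ = here refl
  parent∈nbrs (D i)     _ = here refl

  depth-parent : ∀ x → x ≢ end₀ → suc (depth (parent x)) ≡ depth x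
  depth-parent end₀            x≢ = ⊥-elim (x≢ refl)
  depth-parent end₁            _ = cong (2 +_) (toℕ-fromℕ m)
  depth-parent (spine i)       _ = cong suc (depth-prev i)
  depth-parent (stem i)        _ = refl
  depth-parent (fork₁ i)       _ = refl
  depth-parent (fork₂ i)       _ = refl
  depth-parent (A i)           _ = refl
  depth-parent (B i)           _ = refl
  depth-parent (C i)           _ = refl
  depth-parent (D i)           _ = refl

  depth≡0⇒end₀ : ∀ x → depth x ≡ 0 → x ≡ end₀
  depth≡0⇒end₀ end₀ _ = refl
  depth≡0⇒end₀ end₁ ()

  Label : Set
  Label = Gadgets (suc m) 4

  leafAt : Label → Vertex
  leafAt (inj₁ e)       = inj₁ e
  leafAt (inj₂ (i , t)) = inj₂ (i , 4 ↑ʳ t)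

  leafAt-injective : ∀ {ℓ ℓ′} → leafAt ℓ ≡ leafAt ℓ′ → ℓ ≡ ℓ′
  leafAt-injective {inj₁ _}       {inj₁ _}       refl = refl
  leafAt-injective {inj₂ (i , t)} {inj₂ (j , u)} refl = refl

  leaf-degree : ∀ ℓ → length (nbrs (leafAt ℓ)) ≡ 1
  leaf-degree end₀           = refl
  leaf-degree end₁           = refl
  leaf-degree (inj₂ (i , 0F)) = refl
  leaf-degree (inj₂ (i , 1F)) = refl
  leaf-degree (inj₂ (i , 2F)) = refl
  leaf-degree (inj₂ (i , 3F)) = refl

  inner-or-leaf : ∀ x → length (nbrs x) ≡ 3 ⊎ Σ Label λ ℓ → leafAt ℓ ≡ x
  inner-or-leaf end₀      = inj₂ (end₀ , refl)
  inner-or-leaf end₁      = inj₂ (end₁ , refl)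
  inner-or-leaf (spine i) = inj₁ refl
  inner-or-leaf (stem i)  = inj₁ refl
  inner-or-leaf (fork₁ i) = inj₁ refl
  inner-or-leaf (fork₂ i) = inj₁ refl
  inner-or-leaf (A i)     = inj₂ (inj₂ (i , 0F) , refl)
  inner-or-leaf (B i)     = inj₂ (inj₂ (i , 1F) , refl)
  inner-or-leaf (C i)     = inj₂ (inj₂ (i , 2F) , refl)
  inner-or-leaf (D i)     = inj₂ (inj₂ (i , 3F) , refl)

  open FromNeighbours _≟G_ (gadgets↔ (suc m) 8) nbrs nbrs-unique nbrs-sym nbrs-irrefl public
  open Build end₀ parent depth refl refl depth≡0⇒end₀ depth-parent parent∈nbrs nbr-parent
             (gadgets↔ (suc m) 4) leafAt leafAt-injective leaf-degree inner-or-leaf public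

  #leaves : ℕ
  #leaves = 2 + suc m * 4

  swap-bc : Label → Label
  swap-bc (inj₂ (i , 1F)) = inj₂ (i , 2F)
  swap-bc (inj₂ (i , 2F)) = inj₂ (i , 1F)
  swap-bc ℓ               = ℓ

  swap-bc-involutive : ∀ ℓ → swap-bc (swap-bc ℓ) ≡ ℓ
  swap-bc-involutive end₀            = refl
  swap-bc-involutive end₁            = refl
  swap-bc-involutive (inj₂ (i , 0F)) = refl
  swap-bc-involutive (inj₂ (i , 1F)) = refl
  swap-bc-involutive (inj₂ (i , 2F)) = refl
  swap-bc-involutive (inj₂ (i , 3F)) = refl

  π : Fin #leaves → Fin #leaves
  π = labelOf ∘ swap-bc ∘ labelled

  π-involutive : ∀ x → π (π x) ≡ x
  π-involutive x rewrite labelled-labelOf (swap-bc (labelled x)) | swap-bc-involutive (labelled x) = labelOf-labelled x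

  tree₁ tree₂ : PhyloTree #leaves
  tree₁ = tree
  tree₂ = relabel tree₁ π π-involutive

  -- On block 0F the two trees carry the same labels; on block 1F they differ by the
  -- automorphism exchanging the two forks of each gadget.
  block : Label → Fin 2
  block (inj₂ (_ , 1F)) = 1F
  block (inj₂ (_ , 2F)) = 1F
  block _               = 0F

  blocks : Fin #leaves → Fin 2
  blocks = block ∘ labelled

  swap-bc-block₀ : ∀ ℓ → block ℓ ≡ 0F → swap-bc ℓ ≡ ℓ
  swap-bc-block₀ end₀            _ = refl
  swap-bc-block₀ end₁            _ = refl
  swap-bc-block₀ (inj₂ (i , 0F)) _ = refl
  swap-bc-block₀ (inj₂ (i , 3F)) _ = refl

  identity-iso : IsoOn tree₁ tree₂ (Block blocks 0F)
  identity-iso = record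
    { σ = id ; τ = id ; στ = λ _ → refl ; τσ = λ _ → refl ; adj-pres = λ _ _ → refl
    ; label = λ x b₀ → cong leaf (sym (trans (cong labelOf (swap-bc-block₀ (labelled x) b₀)) (labelOf-labelled x))) }

  swap-kind : Fin 8 → Fin 8
  swap-kind 2F = 3F
  swap-kind 3F = 2F
  swap-kind 4F = 7F
  swap-kind 5F = 6F
  swap-kind 6F = 5F
  swap-kind 7F = 4F
  swap-kind k  = k

  swap : Vertex → Vertex
  swap (inj₁ e)       = inj₁ e
  swap (inj₂ (i , k)) = inj₂ (i , swap-kind k)

  swap-involutive : ∀ x → swap (swap x) ≡ x
  swap-involutive end₀      = refl
  swap-involutive end₁      = refl
  swap-involutive (spine i) = refl
  swap-involutive (stem i)  = refl
  swap-involutive (fork₁ i) = refl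
  swap-involutive (fork₂ i) = refl
  swap-involutive (A i)     = refl
  swap-involutive (B i)     = refl
  swap-involutive (C i)     = refl
  swap-involutive (D i)     = refl

  swap-prev : ∀ i → swap (prev i) ≡ prev i
  swap-prev zero    = refl
  swap-prev (suc _) = refl

  swap-next : ∀ i → swap (next i) ≡ next i
  swap-next i with lastOrInject₁ i
  ... | is-last      = refl
  ... | is-inject₁ _ = refl

  swap-nbrs : ∀ x y → y ∈ nbrs x → swap y ∈ nbrs (swap x)
  swap-nbrs end₀      _ (here refl)                 = here refl
  swap-nbrs end₁      _ (here refl)                 = here refl
  swap-nbrs (spine i) _ (here refl)                 = here (swap-prev i)
  swap-nbrs (spine i) _ (there (here refl))         = there (here (swap-next i))
  swap-nbrs (spine i) _ (there (there (here refl))) = there (there (here refl))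
  swap-nbrs (stem i)  _ (here refl)                 = here refl
  swap-nbrs (stem i)  _ (there (here refl))         = there (there (here refl))
  swap-nbrs (stem i)  _ (there (there (here refl))) = there (here refl)
  swap-nbrs (fork₁ i) _ (here refl)                 = here refl
  swap-nbrs (fork₁ i) _ (there (here refl))         = there (there (here refl))
  swap-nbrs (fork₁ i) _ (there (there (here refl))) = there (here refl)
  swap-nbrs (fork₂ i) _ (here refl)                 = here refl
  swap-nbrs (fork₂ i) _ (there (here refl))         = there (there (here refl))
  swap-nbrs (fork₂ i) _ (there (there (here refl))) = there (here refl)
  swap-nbrs (A i)     _ (here refl)                 = here refl
  swap-nbrs (B i)     _ (here refl)                 = here refl
  swap-nbrs (C i)     _ (here refl)                 = here refl
  swap-nbrs (D i)     _ (here refl)                 = here refl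

  swap-leafAt : ∀ ℓ → block ℓ ≡ 1F → swap (leafAt ℓ) ≡ leafAt (swap-bc ℓ)
  swap-leafAt (inj₂ (i , 1F)) _ = refl
  swap-leafAt (inj₂ (i , 2F)) _ = refl

  swap-iso : IsoOn tree₁ tree₂ (Block blocks 1F)
  swap-iso = record
    { σ = σ ; τ = σ ; στ = σ-involutive ; τσ = σ-involutive
    ; adj-pres = automorphism-adjacent swap swap-nbrs swap-involutive
    ; label = λ x b₁ → cong encode (swap-label (labelled x) b₁) }
    where
    swap-label : ∀ ℓ → block ℓ ≡ 1F → swap (decode (encode (leafAt ℓ))) ≡ leafAt (labelled (labelOf (swap-bc ℓ)))
    swap-label ℓ b₁ = begin
      swap (decode (encode (leafAt ℓ)))       ≡⟨ cong swap (decode-encode (leafAt ℓ)) ⟩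
      swap (leafAt ℓ)                         ≡⟨ swap-leafAt ℓ b₁ ⟩
      leafAt (swap-bc ℓ)                      ≡⟨ cong leafAt (labelled-labelOf (swap-bc ℓ)) ⟨
      leafAt (labelled (labelOf (swap-bc ℓ))) ∎
      where open ≡-Reasoning
    σ : Fin #vertices → Fin #vertices
    σ v = encode (swap (decode v))
    σ-involutive : ∀ v → σ (σ v) ≡ v
    σ-involutive v = trans (cong (encode ∘ swap) (decode-encode (swap (decode v))))
                           (trans (cong encode (swap-involutive (decode v))) (encode-decode v))

  relaxed-forest : HasRAF tree₁ tree₂ 2
  relaxed-forest = blocks , nonempty , λ { 0F → iso⇒RestrEq identity-iso ; 1F → iso⇒RestrEq swap-iso }
    where
    nonempty : ∀ b → Σ (Fin #leaves) λ x → blocks x ≡ b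
    nonempty 0F = labelOf end₀ , cong block (labelled-labelOf end₀)
    nonempty 1F = labelOf (inj₂ (zero , 1F)) , cong block (labelled-labelOf (inj₂ (zero , 1F)))

  quartet : Fin (suc m) → Fin 4 → Fin #leaves
  quartet i t = labelOf (inj₂ (i , t))

  quartet-injective : ∀ {i j t u} → quartet i t ≡ quartet j u → i ≡ j × t ≡ u
  quartet-injective {i} {j} {t} {u} eq with labelOf-injective {inj₂ (i , t)} {inj₂ (j , u)} eq
  ... | refl = refl , refl

  leaf₁-quartet : ∀ i t → PhyloTree.leaf tree₁ (quartet i t) ≡ encode (leafAt (inj₂ (i , t)))
  leaf₁-quartet i t = cong (encode ∘ leafAt) (labelled-labelOf (inj₂ (i , t)))

  leaf₂-quartet : ∀ i t → PhyloTree.leaf tree₂ (quartet i t) ≡ encode (leafAt (swap-bc (inj₂ (i , t))))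
  leaf₂-quartet i t rewrite labelled-labelOf (inj₂ (i , t)) =
    cong (encode ∘ leafAt) (labelled-labelOf (swap-bc (inj₂ (i , t))))

  pendant-leaf : ∀ {v} i t → v ≡ encode (leafAt (inj₂ (i , t))) →
                 PendantAt adjacent v (encode (parent (leafAt (inj₂ (i , t)))))
  pendant-leaf i t refl = pendant (nbrs-leaf t)
    where
    nbrs-leaf : ∀ t → nbrs (leafAt (inj₂ (i , t))) ≡ parent (leafAt (inj₂ (i , t))) ∷ []
    nbrs-leaf 0F = refl
    nbrs-leaf 1F = refl
    nbrs-leaf 2F = refl
    nbrs-leaf 3F = refl

  Side : List Vertex → Fin #vertices → Set
  Side xs v = decode v ∈ xs

  in-side : ∀ {v x xs} → v ≡ encode x → x ∈ xs → Side xs v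
  in-side {x = x} refl x∈ = subst (_∈ _) (sym (decode-encode x)) x∈

  not-in-side : ∀ {v x xs} → v ≡ encode x → x ∉ xs → ¬ Side xs v
  not-in-side {x = x} refl x∉ = x∉ ∘ subst (_∈ _) (decode-encode x)

  side₁ side₂ : Fin (suc m) → List Vertex
  side₁ i = fork₁ i ∷ A i ∷ B i ∷ []
  side₂ i = fork₂ i ∷ C i ∷ D i ∷ []

  side₁-exits : ∀ i → ExitsVia adjacent (Side (side₁ i)) (encode (stem i))
  side₁-exits i = list-exits (side₁ i) (stem i) closed
    where
    closed : ∀ x → x ∈ side₁ i → ∀ y → y ∈ nbrs x → y ∈ side₁ i ⊎ y ≡ stem i
    closed _ (here refl)                 _ (here refl)                 = inj₂ refl
    closed _ (here refl)                 _ (there (here refl))         = inj₁ (there (here refl))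
    closed _ (here refl)                 _ (there (there (here refl))) = inj₁ (there (there (here refl)))
    closed _ (there (here refl))         _ (here refl)                 = inj₁ (here refl)
    closed _ (there (there (here refl))) _ (here refl)                 = inj₁ (here refl)

  side₂-exits : ∀ i → ExitsVia adjacent (Side (side₂ i)) (encode (stem i))
  side₂-exits i = list-exits (side₂ i) (stem i) closed
    where
    closed : ∀ x → x ∈ side₂ i → ∀ y → y ∈ nbrs x → y ∈ side₂ i ⊎ y ≡ stem i
    closed _ (here refl)                 _ (here refl)                 = inj₂ refl
    closed _ (here refl)                 _ (there (here refl))         = inj₁ (there (here refl))
    closed _ (here refl)                 _ (there (there (here refl))) = inj₁ (there (there (here refl)))
    closed _ (there (here refl))         _ (here refl)                 = inj₁ (here refl)
    closed _ (there (there (here refl))) _ (here refl)                 = inj₁ (here refl)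

  stem∉side₁ : ∀ i → stem i ∉ side₁ i
  stem∉side₁ i (there (there (here ())))

  stem∉side₂ : ∀ i → stem i ∉ side₂ i
  stem∉side₂ i (there (there (here ())))

  C∉side₁ : ∀ i → C i ∉ side₁ i
  C∉side₁ i (there (there (here ())))

  A∉side₂ : ∀ i → A i ∉ side₂ i
  A∉side₂ i (there (there (here ())))

  module _ {k} {blk : Fin #leaves → Fin k} (af : IsAF tree₁ tree₂ k blk) where
    private
      disjoint₁ : DisjointSubtrees tree₁ blk
      disjoint₁ = proj₁ (proj₂ af)
      disjoint₂ : DisjointSubtrees tree₂ blk
      disjoint₂ = proj₂ (proj₂ af)

    gadget-not-all-shared : ∀ i → ¬ (∀ t → SharesBlock blk (quartet i t))
    gadget-not-all-shared i shared = fork₁≢fork₂ fork₁≡fork₂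
      where
      a b c d : Fin #leaves
      a = quartet i 0F
      b = quartet i 1F
      c = quartet i 2F
      d = quartet i 3F
      a≡b : blk a ≡ blk b
      a≡b = siblings-same-block tree₁ disjoint₁ (pendant-leaf i 0F (leaf₁-quartet i 0F))
              (pendant-leaf i 1F (leaf₁-quartet i 1F)) (shared 0F) (shared 1F)
      c≡d : blk c ≡ blk d
      c≡d = siblings-same-block tree₁ disjoint₁ (pendant-leaf i 2F (leaf₁-quartet i 2F))
              (pendant-leaf i 3F (leaf₁-quartet i 3F)) (shared 2F) (shared 3F)
      a≡c : blk a ≡ blk c
      a≡c = siblings-same-block tree₂ disjoint₂ (pendant-leaf i 0F (leaf₂-quartet i 0F))
              (pendant-leaf i 1F (leaf₂-quartet i 2F)) (shared 0F) (shared 2F)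

      S₀ : Fin #leaves → Set
      S₀ = Block blk (blk a)
      Sa : S₀ a
      Sa = refl
      Sb : S₀ b
      Sb = sym a≡b
      Sc : S₀ c
      Sc = sym a≡c
      Sd : S₀ d
      Sd = trans (sym c≡d) (sym a≡c)

      distinct : ∀ {t u} → t ≢ u → quartet i t ≢ quartet i u
      distinct {t} {u} t≢u = t≢u ∘ proj₂ ∘ quartet-injective {i} {i} {t} {u}

      side? : ∀ xs → Decidable (Side xs)
      side? xs v = decode v ∈X? xs

      fork₁-kept₁ : Restrict.Kept tree₁ S₀ (encode (fork₁ i))
      fork₁-kept₁ = cherry-parent-kept tree₁ S₀ (side? (side₁ i)) (side₁-exits i)
        (not-in-side refl (stem∉side₁ i))
        (∈⇒adjacent {fork₁ i} {stem i} (here refl)) Sa Sb Sc (distinct {0F} {1F} (λ ()))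
        (pendant-leaf i 0F (leaf₁-quartet i 0F)) (pendant-leaf i 1F (leaf₁-quartet i 1F))
        (in-side (leaf₁-quartet i 0F) (there (here refl))) (in-side (leaf₁-quartet i 1F) (there (there (here refl))))
        (not-in-side (leaf₁-quartet i 2F) (C∉side₁ i))

      fork₁-kept₂ : Restrict.Kept tree₂ S₀ (encode (fork₁ i))
      fork₁-kept₂ = cherry-parent-kept tree₂ S₀ (side? (side₁ i)) (side₁-exits i)
        (not-in-side refl (stem∉side₁ i))
        (∈⇒adjacent {fork₁ i} {stem i} (here refl)) Sa Sc Sb (distinct {0F} {2F} (λ ()))
        (pendant-leaf i 0F (leaf₂-quartet i 0F)) (pendant-leaf i 1F (leaf₂-quartet i 2F))
        (in-side (leaf₂-quartet i 0F) (there (here refl))) (in-side (leaf₂-quartet i 2F) (there (there (here refl))))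
        (not-in-side (leaf₂-quartet i 1F) (C∉side₁ i))

      fork₂-kept₂ : Restrict.Kept tree₂ S₀ (encode (fork₂ i))
      fork₂-kept₂ = cherry-parent-kept tree₂ S₀ (side? (side₂ i)) (side₂-exits i)
        (not-in-side refl (stem∉side₂ i))
        (∈⇒adjacent {fork₂ i} {stem i} (here refl)) Sb Sd Sa (distinct {1F} {3F} (λ ()))
        (pendant-leaf i 2F (leaf₂-quartet i 1F)) (pendant-leaf i 3F (leaf₂-quartet i 3F))
        (in-side (leaf₂-quartet i 1F) (there (here refl))) (in-side (leaf₂-quartet i 3F) (there (there (here refl))))
        (not-in-side (leaf₂-quartet i 0F) (A∉side₂ i))

      fork₁≡fork₂ : encode (fork₁ i) ≡ encode (fork₂ i)
      fork₁≡fork₂ = cherry-parent-unique (proj₂ (proj₁ af) (blk a)) Sa Sb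
        (pendant-leaf i 0F (leaf₁-quartet i 0F)) (pendant-leaf i 1F (leaf₁-quartet i 1F)) fork₁-kept₁
        (pendant-leaf i 0F (leaf₂-quartet i 0F)) fork₁-kept₂
        (pendant-leaf i 2F (leaf₂-quartet i 1F)) fork₂-kept₂

      fork₁≢fork₂ : encode (fork₁ i) ≢ encode (fork₂ i)
      fork₁≢fork₂ eq with encode-injective {fork₁ i} {fork₂ i} eq
      ... | ()

    gadget-singleton : ∀ i → Σ (Fin 4) λ t → Singleton blk (quartet i t)
    gadget-singleton i with any? (λ t → singleton? blk (quartet i t))
    ... | yes found = found
    ... | no none =
      ⊥-elim (gadget-not-all-shared i (λ t → ¬singleton⇒sharesBlock blk _ (λ single → none (t , single))))

    gadgets≤blocks : suc m ≤ k
    gadgets≤blocks = singletons≤blocks blk (λ i → quartet i (proj₁ (gadget-singleton i)))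
                       (proj₁ ∘ quartet-injective) (proj₂ ∘ gadget-singleton)

  agreement-forest-lower-bound : ∀ k → HasAF tree₁ tree₂ k → #leaves ≤ 6 * k
  agreement-forest-lower-bound k (blk , af) = begin
    6 + m * 4   ≤⟨ +-monoʳ-≤ 6 (*-monoʳ-≤ m (s≤s (s≤s (s≤s (s≤s z≤n))))) ⟩
    suc m * 6   ≤⟨ *-monoˡ-≤ 6 (gadgets≤blocks af) ⟩
    k * 6       ≡⟨ *-comm k 6 ⟩
    6 * k       ∎
    where open ≤-Reasoning

  m≤#leaves : m ≤ #leaves
  m≤#leaves = ≤-trans (m≤m*n m 4) (m≤n+m (m * 4) 6)

mainTheorem2 : Σ ℕ λ C → Σ ℕ λ d → 1 ≤ C × 1 ≤ d ×
    (∀ M → Σ ℕ λ N → M ≤ N × Σ (PhyloTree N) λ T₁ → Σ (PhyloTree N) λ T₂ →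
      (Σ ℕ λ k → k ≤ C × HasRAF T₁ T₂ k) ×
      (∀ k → HasAF T₁ T₂ k → N ≤ d * k))
mainTheorem2 = 2 , 6 , s≤s z≤n , s≤s z≤n , λ M → let open Caterpillar M in
  #leaves , m≤#leaves , tree₁ , tree₂ , (2 , ≤-refl , relaxed-forest) , agreement-forest-lower-bound
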